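{- Let $r\ge1$ and $d\ge0$ be integers. If the vertices of a $d$-dimensional face of the Kostka polytope $P_r$ are labeled by $(a_i,b_i,\ell_i)$, $1\le i\le n$, then the set $\{a_1,b_1,\ell_1,\dots,a_n,b_n,\ell_n\}$ has at most $3d+3$ distinct elements.
   Context: For a positive integer $r$, a partition with at most $r$ parts is written as a non-increasing $r$-tuple of nonnegative integers; $\mathrm{Par}_r(n)$ is the set of those with entries summing to $n$. For $\lambda,\mu\in\mathrm{Par}_r(n)$, $\lambda$ dominates $\mu$ if $\sum_{i=1}^k\lambda_i\ge\sum_{i=1}^k\mu_i$ for all $k\le r$. The $r$-Kostka cone $\mathcal{K}_r\subseteq\mathbb{R}^{2r}$ is the convex hull of all points $(\lambda_1,\dots,\lambda_r,\mu_1,\dots,\mu_r)$ with $\lambda,\mu\in\mathrm{Par}_r(n)$ for some $n$ and $\lambda$ dominating $\mu$. The Kostka polytope $P_r$ is $\mathcal{K}_r\cap\{x:\sum_{i=1}^r(\lambda_i+\mu_i)=1\}$, whose vertices are the intersections with the extremal rays of $\mathcal{K}_r$. It is known that the extremal rays of $\mathcal{K}_r$ are exactly the rays spanned by the vectors $\big((a-\ell)^b,0^{r-b};\,(a-\ell)^\ell,(b-\ell)^{a-\ell},0^{r-a}\big)$ for integers $0\le\ell<b\le a\le r$, where exponents denote repetition of an entry. A vertex of $P_r$ on the ray of such a vector with $a\neq b$ (so $0\le\ell<b<a\le r$) is labeled $(a,b,\ell)$; when $a=b$ the ray does not depend on $\ell$, and the vertex is labeled $(a,a,a)$. -}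

module Defs where

open import Data.Nat as ℕ using (ℕ; _∸_; _<ᵇ_; _≡ᵇ_; _<_; _≤_)
open import Data.Integer using (+_)
open import Data.Fin using (Fin; toℕ; zero; suc)
open import Data.Bool using (if_then_else_)
open import Data.Product using (_×_; Σ; ∃-syntax; _,_; proj₁; proj₂)
open import Data.Sum using (_⊎_)
open import Relation.Binary.PropositionalEquality using (_≡_)
open import Data.Rational.Unnormalised as Q using (ℚᵘ; mkℚᵘ; 0ℚᵘ)

record Label : Set where
  constructor lab
  field
    a b ℓ : ℕ
open Label public

ValidLabel : ℕ → Label → Set
ValidLabel r (lab a b ℓ) =
  (ℓ < b × b < a × a ≤ r) ⊎ (ℓ ≡ a × b ≡ a × 1 ≤ a × a ≤ r)

-- The ray generator ((a-ℓ)^b,0^{r-b} ; (a-ℓ)^ℓ,(b-ℓ)^{a-ℓ},0^{r-a}),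
-- coordinates indexed from 0.
genλ : ℕ → ℕ → ℕ → ℕ → ℕ
genλ a b ℓ i = if i <ᵇ b then a ∸ ℓ else 0

genμ : ℕ → ℕ → ℕ → ℕ → ℕ
genμ a b ℓ i = if i <ᵇ ℓ then a ∸ ℓ else (if i <ᵇ a then b ∸ ℓ else 0)

-- for the label (a,a,a) the ray is independent of ℓ; use ℓ = 0
effℓ : Label → ℕ
effℓ (lab a b ℓ) = if a ≡ᵇ b then 0 else ℓ

rayλ rayμ : Label → ℕ → ℕ
rayλ L i = genλ (a L) (b L) (effℓ L) i
rayμ L i = genμ (a L) (b L) (effℓ L) i

sumℕ : (r : ℕ) → (ℕ → ℕ) → ℕ
sumℕ ℕ.zero f = 0
sumℕ (ℕ.suc r) f = sumℕ r f ℕ.+ f r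

-- Coordinate sum of the ray generator (positive for valid labels).
total : ℕ → Label → ℕ
total r L = sumℕ r (λ i → rayλ L i ℕ.+ rayμ L i)

-- Points of ℝ^{2r} (here rational): (λ-part , μ-part)
Point : ℕ → Set
Point r = (Fin r → ℚᵘ) × (Fin r → ℚᵘ)

-- The vertex of P_r with a given label: the ray generator divided by its
-- coordinate sum (mkℚᵘ n k denotes n / (k+1)).
vertex : (r : ℕ) → Label → Point r
vertex r L =
  (λ i → mkℚᵘ (+ rayλ L (toℕ i)) (total r L ∸ 1)) ,
  (λ i → mkℚᵘ (+ rayμ L (toℕ i)) (total r L ∸ 1))

sumQ : (k : ℕ) → (Fin k → ℚᵘ) → ℚᵘ
sumQ ℕ.zero f = 0ℚᵘ
sumQ (ℕ.suc k) f = f zero Q.+ sumQ k (λ j → f (suc j))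

dot : (r : ℕ) → Point r → Point r → ℚᵘ
dot r (c₁ , c₂) (x₁ , x₂) = sumQ r (λ i → c₁ i Q.* x₁ i Q.+ c₂ i Q.* x₂ i)

-- The face of P_r cut out by the linear functional c (maximised on the face).
-- Every face of a polytope is of this form; since P_r is the convex hull of
-- its vertices, the maximum over P_r is the maximum over the vertices.
-- `InFace r c L` : L labels a vertex of P_r lying in this face.
InFace : (r : ℕ) → Point r → Label → Set
InFace r c L = ValidLabel r L ×
  ((L' : Label) → ValidLabel r L' → dot r c (vertex r L') Q.≤ dot r c (vertex r L))

AffInd : (r k : ℕ) → (Fin k → Point r) → Set
AffInd r k p = (t : Fin k → ℚᵘ) →
  sumQ k t Q.≃ 0ℚᵘ →
  ((i : Fin r) → sumQ k (λ j → t j Q.* proj₁ (p j) i) Q.≃ 0ℚᵘ) →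
  ((i : Fin r) → sumQ k (λ j → t j Q.* proj₂ (p j) i) Q.≃ 0ℚᵘ) →
  (j : Fin k) → t j Q.≃ 0ℚᵘ

-- The face cut out by c has (affine) dimension d: it contains d+1 affinely
-- independent vertices, and no larger affinely independent family of vertices.
FaceDim : (r : ℕ) → Point r → ℕ → Set
FaceDim r c d =
  (Σ (Fin (ℕ.suc d) → Label) λ f →
     ((j : Fin (ℕ.suc d)) → InFace r c (f j)) × AffInd r (ℕ.suc d) (λ j → vertex r (f j)))
  × ((k : ℕ) (f : Fin k → Label) → ((j : Fin k) → InFace r c (f j)) →
       AffInd r k (λ j → vertex r (f j)) → k ≤ ℕ.suc d)

LabelEntry : (r : ℕ) → Point r → ℕ → Set
LabelEntry r c x = ∃[ L ] (InFace r c L × (x ≡ a L ⊎ x ≡ b L ⊎ x ≡ ℓ L))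

-- Read along either half of ℝ^{2r}, the ray of the vertex labelled (a,b,ℓ) is a step function
-- that can only change between positions y and y+1 with y+1 ∈ {a,b,ℓ}.  Choose vertices of the
-- face greedily: whenever a label entry x = y+1 of the face is not yet an entry of a chosen
-- vertex, adjoin a vertex having it.  The new vertex jumps at position y while all earlier ones
-- are constant there, so the chosen vertices form a triangular, hence linearly and a fortiori
-- affinely independent, family: there are at most d+1 of them, and every label entry of the
-- face is among their at most 3(d+1) entries.  The entry 0 is no jump position; it is covered
-- by starting the family with a vertex having it.
module Submission where

open import Defs
open import Data.Nat using (ℕ; _≤_; _+_; _*_; zero; suc; _<_; _∸_; _<ᵇ_; _≡ᵇ_; z≤n; s≤s; _<?_)
open import Data.List using (List; length; []; _∷_; concatMap; lookup)
open import Data.List.Relation.Unary.All using (All; []; _∷_)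
open import Data.List.Relation.Unary.Unique.Propositional using (Unique)

open import Data.Nat.Properties
open import Data.Bool using (true; false; T)
open import Data.Bool.Properties using (T-≡)
open import Data.Empty using (⊥-elim)
open import Data.Fin using (Fin; zero; suc; toℕ; fromℕ<)
open import Data.Fin.Properties using (toℕ-fromℕ<)
open import Data.Integer using (+_)
import Data.Integer.Properties as ℤₚ
import Data.List.Relation.Unary.All as All
open import Data.List.Relation.Unary.AllPairs using (_∷_)
open import Data.List.Relation.Unary.Any using (here; there; _─_; index)
open import Data.List.Membership.Propositional using (_∈_; _∉_)
open import Data.List.Membership.Propositional.Properties using (∈-lookup; ∈-++⁺ˡ; ∈-++⁺ʳ)
open import Data.List.Membership.DecPropositional _≟_ using (_∈?_)
open import Data.List.Properties using (length-removeAt′)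
open import Data.List.Relation.Binary.Subset.Propositional using (_⊆_)
open import Data.List.Relation.Binary.Subset.Propositional.Properties
  using (⊆-refl; ⊆-trans; ∈-∷⁺ʳ; xs⊆ys++xs)
open import Data.Product using (Σ; ∃; _×_; _,_; proj₁; proj₂)
open import Data.Sum using (_⊎_; inj₁; inj₂; [_,_]′; reduce)
open import Data.Unit using (tt)
open import Data.Rational.Unnormalised as ℚ using (ℚᵘ; mkℚᵘ; 0ℚᵘ; 1ℚᵘ; _≃_; _≄_; *≡*)
import Data.Rational.Unnormalised.Properties as ℚₚ
open import Function using (_∘_)
open import Function.Bundles using (Equivalence)
open import Relation.Nullary using (yes; no; contradiction)
open import Relation.Binary.PropositionalEquality

sumQ-cong : ∀ k {f g : Fin k → ℚᵘ} → (∀ j → f j ≃ g j) → sumQ k f ≃ sumQ k g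
sumQ-cong zero    _   = ℚₚ.≃-refl
sumQ-cong (suc k) f≃g = ℚₚ.+-cong (f≃g zero) (sumQ-cong k (λ j → f≃g (suc j)))

sumQ-zero : ∀ k {f : Fin k → ℚᵘ} → (∀ j → f j ≃ 0ℚᵘ) → sumQ k f ≃ 0ℚᵘ
sumQ-zero zero    _   = ℚₚ.≃-refl
sumQ-zero (suc k) f≃0 =
  ℚₚ.≃-trans (ℚₚ.+-cong (f≃0 zero) (sumQ-zero k (λ j → f≃0 (suc j)))) (ℚₚ.+-identityˡ 0ℚᵘ)

p*q≃p*r⇒p≃0 : ∀ {p q r} → q ≄ r → p ℚ.* q ≃ p ℚ.* r → p ≃ 0ℚᵘ
p*q≃p*r⇒p≃0 {p} {q} {r} q≄r pq≃pr = begin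
  p                          ≈⟨ ℚₚ.*-identityʳ p ⟨
  p ℚ.* 1ℚᵘ                  ≈⟨ ℚₚ.*-congˡ {p} [q-r]w≃1 ⟨
  p ℚ.* ((q ℚ.- r) ℚ.* w)    ≈⟨ ℚₚ.*-assoc p (q ℚ.- r) w ⟨
  (p ℚ.* (q ℚ.- r)) ℚ.* w    ≈⟨ ℚₚ.*-congʳ {w} p[q-r]≃0 ⟩
  0ℚᵘ ℚ.* w                  ≈⟨ ℚₚ.*-zeroˡ w ⟩
  0ℚᵘ                        ∎
  where
  open ℚₚ.≃-Reasoning
  w = proj₁ (ℚₚ.≄⇒invertible q≄r)
  [q-r]w≃1 = proj₂ (proj₂ (ℚₚ.≄⇒invertible q≄r))
  p[q-r]≃0 : p ℚ.* (q ℚ.- r) ≃ 0ℚᵘ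
  p[q-r]≃0 = begin
    p ℚ.* (q ℚ.- r)                 ≈⟨ ℚₚ.*-distribˡ-+ p q (ℚ.- r) ⟩
    p ℚ.* q ℚ.+ p ℚ.* (ℚ.- r)       ≈⟨ ℚₚ.+-congʳ (p ℚ.* q) (ℚₚ.neg-distribʳ-* p r) ⟨
    p ℚ.* q ℚ.- p ℚ.* r             ≈⟨ ℚₚ.p≃q⇒p-q≃0 _ _ pq≃pr ⟩
    0ℚᵘ                             ∎

data Triangular {A I : Set} (v : A → I → ℚᵘ) : List A → Set where
  [] : Triangular v []
  separated-∷ : ∀ {x xs} (i j : I) → v x i ≄ v x j → All (λ w → v w i ≃ v w j) xs →
                Triangular v xs → Triangular v (x ∷ xs)

combination : {A I : Set} (v : A → I → ℚᵘ) (xs : List A) → (Fin (length xs) → ℚᵘ) → I → ℚᵘ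
combination v xs t i = sumQ (length xs) (λ j → t j ℚ.* v (lookup xs j) i)

triangular⇒independent : ∀ {A I : Set} {v : A → I → ℚᵘ} {xs} → Triangular v xs →
  (t : Fin (length xs) → ℚᵘ) → (∀ i → combination v xs t i ≃ 0ℚᵘ) → ∀ j → t j ≃ 0ℚᵘ
triangular⇒independent {v = v} (separated-∷ {x} {xs} i j vᵢ≄vⱼ agree tri) t comb≃0 = λ where
    zero    → t₀≃0
    (suc k) → triangular⇒independent tri (λ k → t (suc k)) rest≃0 k
  where
  open ℚₚ.≃-Reasoning
  rest = combination v xs (λ k → t (suc k))

  restᵢ≃restⱼ : rest i ≃ rest j
  restᵢ≃restⱼ = sumQ-cong (length xs) (λ k → ℚₚ.*-congˡ {t (suc k)} (All.lookup agree (∈-lookup k)))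

  t₀≃0 : t zero ≃ 0ℚᵘ
  t₀≃0 = p*q≃p*r⇒p≃0 vᵢ≄vⱼ (ℚₚ.+-cancelʳ {rest i} (begin
    t zero ℚ.* v x i ℚ.+ rest i    ≈⟨ comb≃0 i ⟩
    0ℚᵘ                            ≈⟨ comb≃0 j ⟨
    t zero ℚ.* v x j ℚ.+ rest j    ≈⟨ ℚₚ.+-congʳ (t zero ℚ.* v x j) restᵢ≃restⱼ ⟨
    t zero ℚ.* v x j ℚ.+ rest i    ∎))

  rest≃0 : ∀ k → rest k ≃ 0ℚᵘ
  rest≃0 k = begin
    rest k                         ≈⟨ ℚₚ.+-identityˡ (rest k) ⟨
    0ℚᵘ ℚ.+ rest k                 ≈⟨ ℚₚ.+-congˡ (rest k) (ℚₚ.*-zeroˡ (v x k)) ⟨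
    0ℚᵘ ℚ.* v x k ℚ.+ rest k       ≈⟨ ℚₚ.+-congˡ (rest k) (ℚₚ.*-congʳ {v x k} t₀≃0) ⟨
    t zero ℚ.* v x k ℚ.+ rest k    ≈⟨ comb≃0 k ⟩
    0ℚᵘ                            ∎

∈-─ : ∀ {A : Set} {x z : A} {ys} (x∈ys : x ∈ ys) → z ∈ ys → x ≢ z → z ∈ (ys ─ x∈ys)
∈-─ (here refl) (here refl)  x≢z = contradiction refl x≢z
∈-─ (here refl) (there z∈ys) _   = z∈ys
∈-─ (there _)   (here refl)  _   = here refl
∈-─ (there x∈ys) (there z∈ys) x≢z = there (∈-─ x∈ys z∈ys x≢z)

unique∧⊆⇒length≤ : ∀ {A : Set} {xs ys : List A} → Unique xs → xs ⊆ ys → length xs ≤ length ys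
unique∧⊆⇒length≤ {xs = []}     _                  _     = z≤n
unique∧⊆⇒length≤ {xs = x ∷ xs} {ys} (x∉xs ∷ unique) xs⊆ys = begin
  suc (length xs)            ≤⟨ s≤s (unique∧⊆⇒length≤ unique xs⊆ys─x) ⟩
  suc (length (ys ─ x∈ys))   ≡⟨ length-removeAt′ ys (index x∈ys) ⟨
  length ys                  ∎
  where
  open ≤-Reasoning
  x∈ys = xs⊆ys (here refl)
  xs⊆ys─x : xs ⊆ (ys ─ x∈ys)
  xs⊆ys─x z∈xs = ∈-─ x∈ys (xs⊆ys (there z∈xs)) (All.lookup x∉xs z∈xs)

<ᵇ-true : ∀ {m n} → m < n → (m <ᵇ n) ≡ true
<ᵇ-true m<n = Equivalence.to T-≡ (<⇒<ᵇ m<n)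

<ᵇ-false : ∀ {m n} → n ≤ m → (m <ᵇ n) ≡ false
<ᵇ-false {m} {n} n≤m with m <ᵇ n in eq
... | false = refl
... | true  = contradiction (<ᵇ⇒< m n (subst T (sym eq) tt)) (≤⇒≯ n≤m)

<ᵇ-suc : ∀ m n → suc m ≢ n → (m <ᵇ n) ≡ (suc m <ᵇ n)
<ᵇ-suc zero    zero          _  = refl
<ᵇ-suc zero    (suc zero)    ne = contradiction refl ne
<ᵇ-suc zero    (suc (suc n)) _  = refl
<ᵇ-suc (suc m) zero          _  = refl
<ᵇ-suc (suc m) (suc n)       ne = <ᵇ-suc m n (ne ∘ cong suc)

genλ-< : ∀ a b e {y} → y < b → genλ a b e y ≡ a ∸ e
genλ-< a b e y<b rewrite <ᵇ-true y<b = refl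

genλ-≥ : ∀ a b e {y} → b ≤ y → genλ a b e y ≡ 0
genλ-≥ a b e b≤y rewrite <ᵇ-false b≤y = refl

genλ-suc : ∀ a b e y → suc y ≢ b → genλ a b e y ≡ genλ a b e (suc y)
genλ-suc a b e y y+1≢b rewrite <ᵇ-suc y b y+1≢b = refl

genμ-< : ∀ a b e {y} → y < e → genμ a b e y ≡ a ∸ e
genμ-< a b e y<e rewrite <ᵇ-true y<e = refl

genμ-middle : ∀ a b e {y} → e ≤ y → y < a → genμ a b e y ≡ b ∸ e
genμ-middle a b e e≤y y<a rewrite <ᵇ-false e≤y | <ᵇ-true y<a = refl

genμ-≥ : ∀ a b e {y} → e ≤ y → a ≤ y → genμ a b e y ≡ 0
genμ-≥ a b e e≤y a≤y rewrite <ᵇ-false e≤y | <ᵇ-false a≤y = refl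

genμ-suc : ∀ a b e y → suc y ≢ e → suc y ≢ a → genμ a b e y ≡ genμ a b e (suc y)
genμ-suc a b e y y+1≢e y+1≢a rewrite <ᵇ-suc y e y+1≢e | <ᵇ-suc y a y+1≢a = refl

effℓ-generic : ∀ {A B l} → B < A → effℓ (lab A B l) ≡ l
effℓ-generic {A} {B} B<A with A ≡ᵇ B in eq
... | false = refl
... | true  = contradiction (≡ᵇ⇒≡ A B (subst T (sym eq) tt)) (>⇒≢ B<A)

effℓ-diagonal : ∀ A → effℓ (lab A A A) ≡ 0
effℓ-diagonal A with A ≡ᵇ A in eq
... | true  = refl
... | false = ⊥-elim (subst T eq (≡⇒≡ᵇ A A refl))

data Shape : Label → Set where
  generic  : ∀ {A B l} → l < B → B < A → Shape (lab A B l)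
  diagonal : ∀ {A} → 1 ≤ A → Shape (lab A A A)

shape : ∀ {r} L → ValidLabel r L → Shape L
shape (lab A B l) (inj₁ (l<B , B<A , _))               = generic l<B B<A
shape (lab A .A .A) (inj₂ (refl , refl , 1≤A , _))     = diagonal 1≤A

a≤r : ∀ {r} L → ValidLabel r L → a L ≤ r
a≤r _ (inj₁ (_ , _ , A≤r))     = A≤r
a≤r _ (inj₂ (_ , _ , _ , A≤r)) = A≤r

labelEntries : Label → List ℕ
labelEntries L = a L ∷ b L ∷ ℓ L ∷ []

∈-labelEntries : ∀ L {x} → x ≡ a L ⊎ x ≡ b L ⊎ x ≡ ℓ L → x ∈ labelEntries L
∈-labelEntries L (inj₁ x≡a)        = here x≡a
∈-labelEntries L (inj₂ (inj₁ x≡b)) = there (here x≡b)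
∈-labelEntries L (inj₂ (inj₂ x≡ℓ)) = there (there (here x≡ℓ))

positive-entry : ∀ {r} L → ValidLabel r L → ∃ λ y → suc y ∈ labelEntries L
positive-entry L valid with shape L valid
... | generic {suc A} _ _ = A , here refl
... | diagonal {suc A} _  = A , here refl

Flat : Label → ℕ → Set
Flat L y = rayλ L y ≡ rayλ L (suc y) × rayμ L y ≡ rayμ L (suc y)

Jump : Label → ℕ → Set
Jump L y = rayλ L y ≢ rayλ L (suc y) ⊎ rayμ L y ≢ rayμ L (suc y)

flat-off-entries : ∀ {r} L → ValidLabel r L → ∀ y → suc y ∉ labelEntries L → Flat L y
flat-off-entries L valid y y+1∉ with shape L valid
... | generic {A} {B} {l} _ B<A rewrite effℓ-generic {l = l} B<A =
  genλ-suc A B l y (y+1∉ ∘ there ∘ here) ,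
  genμ-suc A B l y (y+1∉ ∘ there ∘ there ∘ here) (y+1∉ ∘ here)
... | diagonal {A} _ rewrite effℓ-diagonal A =
  genλ-suc A A 0 y (y+1∉ ∘ here) , genμ-suc A A 0 y (λ ()) (y+1∉ ∘ here)

diagonal-jump : ∀ y → Jump (lab (suc y) (suc y) (suc y)) y
diagonal-jump y rewrite effℓ-diagonal (suc y) =
  inj₁ (subst₂ _≢_ (sym (genλ-< (suc y) (suc y) 0 ≤-refl)) (sym (genλ-≥ (suc y) (suc y) 0 ≤-refl)) λ ())

jump-at-entries : ∀ {r} L → ValidLabel r L → ∀ y → suc y ∈ labelEntries L → Jump L y
jump-at-entries L valid y y+1∈ with shape L valid | y+1∈
... | generic {A} {B} {l} l<B B<A | here refl rewrite effℓ-generic {l = l} B<A =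
  inj₂ (subst₂ _≢_ (sym (genμ-middle A B l (<⇒≤ (<-≤-trans l<B (≤-pred B<A))) ≤-refl))
                   (sym (genμ-≥ A B l (<⇒≤ (<-trans l<B B<A)) ≤-refl))
                   (m>n⇒m∸n≢0 l<B))
... | generic {A} {B} {l} l<B B<A | there (here refl) rewrite effℓ-generic {l = l} B<A =
  inj₁ (subst₂ _≢_ (sym (genλ-< A B l ≤-refl)) (sym (genλ-≥ A B l ≤-refl))
                   (m>n⇒m∸n≢0 (<-trans l<B B<A)))
... | generic {A} {B} {l} l<B B<A | there (there (here refl)) rewrite effℓ-generic {l = l} B<A =
  inj₂ (subst₂ _≢_ (sym (genμ-< A B l ≤-refl)) (sym (genμ-middle A B l ≤-refl (<-trans l<B B<A)))
                   (λ A∸l≡B∸l → >⇒≢ B<A (∸-cancelʳ-≡ (<⇒≤ (<-trans l<B B<A)) (<⇒≤ l<B) A∸l≡B∸l)))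
... | diagonal _ | here refl                 = diagonal-jump y
... | diagonal _ | there (here refl)         = diagonal-jump y
... | diagonal _ | there (there (here refl)) = diagonal-jump y

vanish-from-a : ∀ {r} L → ValidLabel r L → ∀ {i} → a L ≤ i → rayλ L i ≡ 0 × rayμ L i ≡ 0
vanish-from-a L valid {i} a≤i with shape L valid
... | generic {A} {B} {l} l<B B<A rewrite effℓ-generic {l = l} B<A =
  genλ-≥ A B l (≤-trans (<⇒≤ B<A) a≤i) , genμ-≥ A B l (≤-trans (<⇒≤ (<-trans l<B B<A)) a≤i) a≤i
... | diagonal {A} _ rewrite effℓ-diagonal A = genλ-≥ A A 0 a≤i , genμ-≥ A A 0 z≤n a≤i

-- The coordinates of vertex r L, indexed by inj₁ i (λ-part) and inj₂ i (μ-part) for all i : ℕ,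
-- so that they continue by zeros beyond r.
vertexCoord : ℕ → Label → ℕ ⊎ ℕ → ℚᵘ
vertexCoord r L k = mkℚᵘ (+ [ rayλ L , rayμ L ]′ k) (total r L ∸ 1)

vertexCoord-cong : ∀ r L k k′ → [ rayλ L , rayμ L ]′ k ≡ [ rayλ L , rayμ L ]′ k′ →
  vertexCoord r L k ≃ vertexCoord r L k′
vertexCoord-cong r L _ _ eq = ℚₚ.≃-reflexive (cong (λ n → mkℚᵘ (+ n) (total r L ∸ 1)) eq)

vertexCoord-injective : ∀ r L k k′ → vertexCoord r L k ≃ vertexCoord r L k′ →
  [ rayλ L , rayμ L ]′ k ≡ [ rayλ L , rayμ L ]′ k′
vertexCoord-injective r L _ _ (*≡* eq) = ℤₚ.+-injective (ℤₚ.*-cancelʳ-≡ _ _ (+ suc (total r L ∸ 1)) eq)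

vertexCoord-beyond : ∀ r L → ValidLabel r L → ∀ k → r ≤ reduce k → vertexCoord r L k ≃ 0ℚᵘ
vertexCoord-beyond r L valid (inj₁ i) r≤i
  rewrite proj₁ (vanish-from-a L valid (≤-trans (a≤r L valid) r≤i)) = *≡* refl
vertexCoord-beyond r L valid (inj₂ i) r≤i
  rewrite proj₂ (vanish-from-a L valid (≤-trans (a≤r L valid) r≤i)) = *≡* refl

triangular-∷ : ∀ {r L Ls y} → Jump L y → All (λ L′ → Flat L′ y) Ls →
  Triangular (vertexCoord r) Ls → Triangular (vertexCoord r) (L ∷ Ls)
triangular-∷ {r} {L} {y = y} (inj₁ λ-jump) flats =
  separated-∷ (inj₁ y) (inj₁ (suc y)) (λ-jump ∘ vertexCoord-injective r L (inj₁ y) (inj₁ (suc y)))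
    (All.map (λ {L′} flat → vertexCoord-cong r L′ (inj₁ y) (inj₁ (suc y)) (proj₁ flat)) flats)
triangular-∷ {r} {L} {y = y} (inj₂ μ-jump) flats =
  separated-∷ (inj₂ y) (inj₂ (suc y)) (μ-jump ∘ vertexCoord-injective r L (inj₂ y) (inj₂ (suc y)))
    (All.map (λ {L′} flat → vertexCoord-cong r L′ (inj₂ y) (inj₂ (suc y)) (proj₂ flat)) flats)

Fin-or-beyond : ∀ r {P : ℕ → Set} → (∀ (i : Fin r) → P (toℕ i)) → (∀ i → r ≤ i → P i) → ∀ i → P i
Fin-or-beyond r {P} below beyond i with i <? r
... | yes i<r = subst P (toℕ-fromℕ< i<r) (below (fromℕ< i<r))
... | no  i≮r = beyond i (≮⇒≥ i≮r)

triangular⇒affInd : ∀ r Ls → All (ValidLabel r) Ls → Triangular (vertexCoord r) Ls →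
  AffInd r (length Ls) (λ j → vertex r (lookup Ls j))
triangular⇒affInd r Ls valid tri t _ λ-comb≃0 μ-comb≃0 = triangular⇒independent tri t comb≃0
  where
  comb = combination (vertexCoord r) Ls t

  comb-beyond : ∀ k → r ≤ reduce k → comb k ≃ 0ℚᵘ
  comb-beyond k r≤k = sumQ-zero (length Ls) λ j →
    ℚₚ.≃-trans (ℚₚ.*-congˡ {t j} (vertexCoord-beyond r (lookup Ls j) (All.lookup valid (∈-lookup j)) k r≤k))
               (ℚₚ.*-zeroʳ (t j))

  comb≃0 : ∀ k → comb k ≃ 0ℚᵘ
  comb≃0 (inj₁ i) = Fin-or-beyond r λ-comb≃0 (λ i → comb-beyond (inj₁ i)) i
  comb≃0 (inj₂ i) = Fin-or-beyond r μ-comb≃0 (λ i → comb-beyond (inj₂ i)) i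

entries : List Label → List ℕ
entries = concatMap labelEntries

length-entries : ∀ Ls → length (entries Ls) ≡ 3 * length Ls
length-entries []       = refl
length-entries (L ∷ Ls) = trans (cong (λ n → 3 + n) (length-entries Ls)) (sym (*-suc 3 (length Ls)))

flat-off-all-entries : ∀ {r} Ls → All (ValidLabel r) Ls → ∀ {y} → suc y ∉ entries Ls →
  All (λ L → Flat L y) Ls
flat-off-all-entries []       []             _     = []
flat-off-all-entries (L ∷ Ls) (valid ∷ valids) y+1∉ =
  flat-off-entries L valid _ (y+1∉ ∘ ∈-++⁺ˡ) ∷
  flat-off-all-entries Ls valids (y+1∉ ∘ ∈-++⁺ʳ (labelEntries L))

module _ (r : ℕ) (c : Point r) where

  record TriangularFamily : Set where
    field
      labels     : List Label
      inFace     : All (InFace r c) labels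
      triangular : Triangular (vertexCoord r) labels
  open TriangularFamily

  covered : TriangularFamily → List ℕ
  covered F = entries (labels F)

  empty : TriangularFamily
  empty = record { labels = [] ; inFace = [] ; triangular = [] }

  adjoin : (F : TriangularFamily) (L : Label) → InFace r c L →
    ∀ {y} → suc y ∈ labelEntries L → suc y ∉ covered F → TriangularFamily
  adjoin F L L∈face {y} y+1∈L y+1∉F = record
    { labels     = L ∷ labels F
    ; inFace     = L∈face ∷ inFace F
    ; triangular = triangular-∷ {r} (jump-at-entries L (proj₁ L∈face) y y+1∈L)
                     (flat-off-all-entries (labels F) (All.map proj₁ (inFace F)) y+1∉F)
                     (triangular F)
    }

  cover-entry : (F : TriangularFamily) → ∀ x → LabelEntry r c x → (x ≡ 0 → x ∈ covered F) →
    Σ TriangularFamily λ F′ → covered F ⊆ covered F′ × x ∈ covered F′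
  cover-entry F x _ _ with x ∈? covered F
  ... | yes x∈F = F , ⊆-refl , x∈F
  cover-entry F zero _ 0∈F | no 0∉F = contradiction (0∈F refl) 0∉F
  cover-entry F (suc y) (L , L∈face , entry) _ | no y+1∉F =
    adjoin F L L∈face y+1∈L y+1∉F , xs⊆ys++xs (covered F) (labelEntries L) , ∈-++⁺ˡ y+1∈L
    where y+1∈L = ∈-labelEntries L entry

  cover : (F : TriangularFamily) → ∀ xs → All (LabelEntry r c) xs → (0 ∈ xs → 0 ∈ covered F) →
    Σ TriangularFamily λ F′ → covered F ⊆ covered F′ × xs ⊆ covered F′
  cover F []       []                       _        = F , ⊆-refl , λ ()
  cover F (x ∷ xs) (x-entry ∷ xs-entries) 0-covered =
    let F₁ , F⊆F₁  , x∈F₁  = cover-entry F x x-entry (λ { refl → 0-covered (here refl) })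
        F₂ , F₁⊆F₂ , xs⊆F₂ = cover F₁ xs xs-entries (F⊆F₁ ∘ 0-covered ∘ there)
    in F₂ , ⊆-trans F⊆F₁ F₁⊆F₂ , ∈-∷⁺ʳ (F₁⊆F₂ x∈F₁) xs⊆F₂

  initial : ∀ xs → All (LabelEntry r c) xs → Σ TriangularFamily λ F → 0 ∈ xs → 0 ∈ covered F
  initial xs xs-entries with 0 ∈? xs
  ... | no 0∉xs = empty , λ 0∈xs → contradiction 0∈xs 0∉xs
  ... | yes 0∈xs with All.lookup xs-entries 0∈xs
  ...   | L , L∈face , 0-entry with positive-entry L (proj₁ L∈face)
  ...     | _ , y+1∈L = adjoin empty L L∈face y+1∈L (λ ()) , λ _ → ∈-++⁺ˡ (∈-labelEntries L 0-entry)

  covering-family : ∀ xs → All (LabelEntry r c) xs → Σ TriangularFamily λ F → xs ⊆ covered F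
  covering-family xs xs-entries =
    let F₀ , 0-covered = initial xs xs-entries
        F  , _ , xs⊆F  = cover F₀ xs xs-entries 0-covered
    in  F , xs⊆F

  family-size : ∀ {d} → FaceDim r c d → (F : TriangularFamily) → length (labels F) ≤ suc d
  family-size (_ , maximal) F =
    maximal _ (lookup (labels F)) (λ j → All.lookup (inFace F) (∈-lookup j))
      (triangular⇒affInd r (labels F) (All.map proj₁ (inFace F)) (triangular F))

open TriangularFamily using (labels)

lemma4p4 : (r : ℕ) → 1 ≤ r → (d : ℕ) → (c : Point r) → FaceDim r c d →
    (xs : List ℕ) → Unique xs → All (LabelEntry r c) xs → length xs ≤ 3 * d + 3
lemma4p4 r _ d c face-dim xs unique xs-entries with covering-family r c xs xs-entries
... | F , xs⊆F = begin
  length xs                ≤⟨ unique∧⊆⇒length≤ unique xs⊆F ⟩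
  length (covered r c F)   ≡⟨ length-entries (labels F) ⟩
  3 * length (labels F)    ≤⟨ *-monoʳ-≤ 3 (family-size r c face-dim F) ⟩
  3 * suc d                ≡⟨ *-suc 3 d ⟩
  3 + 3 * d                ≡⟨ +-comm 3 (3 * d) ⟩
  3 * d + 3                ∎
  where open ≤-Reasoning
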